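{- Let $M$ be a matroid with ground set $E$, let $t\ge 0$ be an integer, let $e\in E$, and let $(A,B)$ be a partition of $E$ with $\lambda_M(A)<t+1$. (i) If $e\in \mathrm{cl}(A-\{e\})\cap\mathrm{cl}(B-\{e\})$, then $e$ has freedom at most $t$ in $M$. (ii) If $e\in \mathrm{cl}^*(A-\{e\})\cap\mathrm{cl}^*(B-\{e\})$, then $e$ has cofreedom at most $t$ in $M$.
   Context: $\lambda_M(X)=r(X)+r(E-X)-r(M)$ is the connectivity function; a partition $(X,E-X)$ with $\lambda_M(X)<k$ is a $k$-separation. $\mathrm{cl}$ is the closure operator of $M$ and $\mathrm{cl}^*$ the closure operator of $M^*$. Elements are clones if swapping their labels is an automorphism; a clonal class is a maximal set of pairwise clones. The freedom of $e$ is the maximum size of an independent clonal class containing $e$ among all extensions of $M$ (infinite if $e$ is a coloop); the cofreedom of $e$ is its freedom in $M^*$. -}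

module Defs where

open import Data.Nat using (ℕ; _+_; _∸_; _≤_; _<_)
open import Data.Fin using (Fin; _↑ˡ_)
open import Data.Fin.Properties using (_≟_)
open import Data.Fin.Subset using (Subset; _∪_; _∩_; _⊆_; ∁; ⁅_⁆; ∣_∣; _∈_; ⊤; _-_)
open import Data.Vec using (_++_; replicate; tabulate; lookup)
open import Data.Bool using (false)
open import Relation.Binary.PropositionalEquality using (_≡_)
open import Relation.Nullary using (yes; no)
open import Data.Product using (Σ; _×_)

record Matroid (n : ℕ) : Set where
  field
    rank       : Subset n → ℕ
    rank-bound : ∀ X → rank X ≤ ∣ X ∣
    rank-mono  : ∀ X Y → X ⊆ Y → rank X ≤ rank Y
    rank-submod : ∀ X Y → rank (X ∪ Y) + rank (X ∩ Y) ≤ rank X + rank Y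
open Matroid public

connectivity : ∀ {n} → Matroid n → Subset n → ℕ
connectivity M X = rank M X + rank M (∁ X) ∸ rank M ⊤

dualRank : ∀ {n} → Matroid n → Subset n → ℕ
dualRank M X = ∣ X ∣ + rank M (∁ X) ∸ rank M ⊤

InClosure : ∀ {n} → (Subset n → ℕ) → Fin n → Subset n → Set
InClosure r e X = r (X ∪ ⁅ e ⁆) ≡ r X

InCl : ∀ {n} → Matroid n → Fin n → Subset n → Set
InCl M = InClosure (rank M)

InCoCl : ∀ {n} → Matroid n → Fin n → Subset n → Set
InCoCl M = InClosure (dualRank M)

swap : ∀ {k} → Fin k → Fin k → Fin k → Fin k
swap x y i with i ≟ x
... | yes _ = y
... | no _ with i ≟ y
...   | yes _ = x
...   | no _  = i

swapSet : ∀ {k} → Fin k → Fin k → Subset k → Subset k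
swapSet x y X = tabulate (λ i → lookup X (swap x y i))

Clones : ∀ {k} → Matroid k → Fin k → Fin k → Set
Clones N x y = ∀ X → rank N (swapSet x y X) ≡ rank N X

ClonalClass : ∀ {k} → Matroid k → Subset k → Set
ClonalClass N C =
  (∀ x y → x ∈ C → y ∈ C → Clones N x y) ×
  (∀ z → (∀ x → x ∈ C → Clones N x z) → z ∈ C)

Independent : ∀ {k} → Matroid k → Subset k → Set
Independent N C = rank N C ≡ ∣ C ∣

IsExtension : ∀ {n m} → (Subset n → ℕ) → Matroid (n + m) → Set
IsExtension {m = m} r N = ∀ X → rank N (X ++ replicate m false) ≡ r X

-- "e has freedom at most t" in the matroid with rank function r:
-- every independent clonal class containing e in every extension has
-- size at most t.  (If e is a coloop such classes are unbounded, matching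
-- the convention that a coloop has infinite freedom.)
FreedomAtMostOf : ∀ {n} → (Subset n → ℕ) → Fin n → ℕ → Set
FreedomAtMostOf {n} r e t =
  ∀ (m : ℕ) (N : Matroid (n + m)) → IsExtension r N →
  ∀ (C : Subset (n + m)) → ClonalClass N C → Independent N C →
  (e ↑ˡ m) ∈ C → ∣ C ∣ ≤ t

FreedomAtMost : ∀ {n} → Matroid n → Fin n → ℕ → Set
FreedomAtMost M = FreedomAtMostOf (rank M)

CofreedomAtMost : ∀ {n} → Matroid n → Fin n → ℕ → Set
CofreedomAtMost M = FreedomAtMostOf (dualRank M)

-- In an extension N of M, every element of an independent clonal class C containing e is, like e,
-- in the closure of X = A - e and of Y = E - A - e; hence r(X ∪ C) = r(X) and r(Y ∪ C) = r(Y).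
-- Submodularity applied to X ∪ C and Y ∪ C, whose union is spanning and whose intersection
-- contains C, gives |C| + r(M) ≤ r(A) + r(E - A), that is |C| ≤ λ(A) ≤ t.  Nothing about M is used
-- beyond N being a matroid that extends its rank function, so the same argument applies to M*,
-- and λ_{M*} = λ_M.
module Submission where

open import Defs
open import Data.Product using (_×_; _,_)
open import Data.Bool using (true; false; _∨_)
open import Data.Bool.Properties using (∨-identityʳ)
open import Data.Empty using (⊥-elim)
open import Data.Fin using (Fin; zero; suc; _↑ˡ_)
open import Data.Fin.Properties using (_≟_)
open import Data.Fin.Subset
open import Data.Fin.Subset.Properties
open import Data.List using (List; []; _∷_; map; filter; allFin)
import Data.List.Membership.Propositional as List
open import Data.List.Membership.Propositional.Properties using (∈-allFin; ∈-filter⁺; ∈-map⁺)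
import Data.List.Relation.Unary.All as All
open import Data.List.Relation.Unary.All using (All; []; _∷_)
open import Data.List.Relation.Unary.All.Properties using (all-filter; map⁺)
import Data.List.Relation.Unary.Any as Any
open import Data.Nat using (ℕ; suc; _+_; _∸_; _≤_; _<_)
open import Data.Nat.Properties hiding (_≟_)
open import Data.Nat.Tactic.RingSolver using (solve-∀)
open import Data.Sum using (inj₁; inj₂)
open import Data.Vec using ([]; _∷_; _++_; replicate; lookup; here; there)
open import Data.Vec.Properties
  using (tabulate-cong; tabulate∘lookup; lookup-zipWith; lookup-++ˡ; zipWith-++; []=⇒lookup; lookup⇒[]=)
import Algebra.Lattice.Properties.BooleanAlgebra as BooleanAlgebraProperties
import Algebra.Solver.IdempotentCommutativeMonoid as ICMSolver
open import Function using (_∘_)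
open import Relation.Binary.PropositionalEquality
open import Relation.Nullary using (yes; no)

lookup-∉ : ∀ {k} {x : Fin k} {p : Subset k} → x ∉ p → lookup p x ≡ false
lookup-∉ {x = x} {p} x∉p with lookup p x in eq
... | true  = ⊥-elim (x∉p (lookup⇒[]= x p eq))
... | false = refl

lookup-∪⁅⁆-≢ : ∀ {k} (X : Subset k) {i j : Fin k} → i ≢ j → lookup (X ∪ ⁅ j ⁆) i ≡ lookup X i
lookup-∪⁅⁆-≢ X {i} {j} i≢j = begin
  lookup (X ∪ ⁅ j ⁆) i        ≡⟨ lookup-zipWith _∨_ i X ⁅ j ⁆ ⟩
  lookup X i ∨ lookup ⁅ j ⁆ i ≡⟨ cong (lookup X i ∨_) (lookup-∉ (x≢y⇒x∉⁅y⁆ i≢j)) ⟩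
  lookup X i ∨ false          ≡⟨ ∨-identityʳ _ ⟩
  lookup X i                  ∎
  where open ≡-Reasoning

swapSet-∪⁅⁆ : ∀ {k} {X : Subset k} {x y : Fin k} → x ∉ X → y ∉ X →
  swapSet x y (X ∪ ⁅ y ⁆) ≡ X ∪ ⁅ x ⁆
swapSet-∪⁅⁆ {X = X} {x} {y} x∉X y∉X =
  trans (tabulate-cong pointwise) (tabulate∘lookup (X ∪ ⁅ x ⁆))
  where
  lookup-∪⁅⁆-self : ∀ j → lookup (X ∪ ⁅ j ⁆) j ≡ true
  lookup-∪⁅⁆-self j = []=⇒lookup (q⊆p∪q X ⁅ j ⁆ (x∈⁅x⁆ j))

  pointwise : ∀ i → lookup (X ∪ ⁅ y ⁆) (swap x y i) ≡ lookup (X ∪ ⁅ x ⁆) i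
  pointwise i with i ≟ x
  ... | yes refl = trans (lookup-∪⁅⁆-self y) (sym (lookup-∪⁅⁆-self x))
  ... | no i≢x with i ≟ y
  ...   | yes refl = trans (lookup-∪⁅⁆-≢ X (i≢x ∘ sym))
                       (trans (lookup-∉ x∉X) (sym (trans (lookup-∪⁅⁆-≢ X i≢x) (lookup-∉ y∉X))))
  ...   | no i≢y = trans (lookup-∪⁅⁆-≢ X i≢y) (sym (lookup-∪⁅⁆-≢ X i≢x))

x∉p-x : ∀ {k} (p : Subset k) (x : Fin k) → x ∉ p - x
x∉p-x (_ ∷ p) zero    ()
x∉p-x (_ ∷ p) (suc x) (there x∈p-x) = x∉p-x p x x∈p-x

p-x∪∁p-x∪⁅x⁆≡⊤ : ∀ {k} (p : Subset k) (x : Fin k) → ((p - x) ∪ (∁ p - x)) ∪ ⁅ x ⁆ ≡ ⊤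
p-x∪∁p-x∪⁅x⁆≡⊤ p x = ⊆-antisym ⊆⊤ covered
  where
  covered : ⊤ ⊆ ((p - x) ∪ (∁ p - x)) ∪ ⁅ x ⁆
  covered {y} _ with y ≟ x | y ∈? p
  ... | yes refl | _     = q⊆p∪q _ ⁅ y ⁆ (x∈⁅x⁆ y)
  ... | no y≢x  | yes y∈p = p⊆p∪q ⁅ x ⁆ (p⊆p∪q (∁ p - x) (x∈p∧x≢y⇒x∈p-y y∈p y≢x))
  ... | no y≢x  | no y∉p  = p⊆p∪q ⁅ x ⁆ (q⊆p∪q (p - x) _ (x∈p∧x≢y⇒x∈p-y (x∉p⇒x∈∁p y∉p) y≢x))

∈-⋃⁺ : ∀ {k} {x : Fin k} {P : Subset k} {Ps : List (Subset k)} → x ∈ P → P List.∈ Ps → x ∈ ⋃ Ps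
∈-⋃⁺ {Ps = Q ∷ Ps} x∈P (Any.here refl)  = p⊆p∪q (⋃ Ps) x∈P
∈-⋃⁺ {Ps = Q ∷ Ps} x∈P (Any.there P∈Ps) = q⊆p∪q Q (⋃ Ps) (∈-⋃⁺ x∈P P∈Ps)

infixl 5 _↑ˢ_
_↑ˢ_ : ∀ {n} → Subset n → ∀ m → Subset (n + m)
X ↑ˢ m = X ++ replicate m false

module _ (m : ℕ) where

  ↑ˢ-⊥ : ∀ {n} → ⊥ {n} ↑ˢ m ≡ ⊥
  ↑ˢ-⊥ {0}     = refl
  ↑ˢ-⊥ {suc n} = cong (false ∷_) ↑ˢ-⊥

  ↑ˢ-⁅⁆ : ∀ {n} (x : Fin n) → ⁅ x ⁆ ↑ˢ m ≡ ⁅ x ↑ˡ m ⁆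
  ↑ˢ-⁅⁆ zero    = cong (true ∷_) ↑ˢ-⊥
  ↑ˢ-⁅⁆ (suc x) = cong (false ∷_) (↑ˢ-⁅⁆ x)

  ↑ˢ-∪ : ∀ {n} (p q : Subset n) → (p ∪ q) ↑ˢ m ≡ (p ↑ˢ m) ∪ (q ↑ˢ m)
  ↑ˢ-∪ p q = sym (trans (zipWith-++ _∨_ p _ q _) (cong ((p ∪ q) ++_) (∪-idem _)))

  ↑ˢ-⊆ : ∀ {n} {p q : Subset n} → p ⊆ q → p ↑ˢ m ⊆ q ↑ˢ m
  ↑ˢ-⊆ {p = []}    {[]}    _   x∈p = x∈p
  ↑ˢ-⊆ {p = _ ∷ p} {_ ∷ q} p⊆q {zero} here with p⊆q here
  ... | here = here
  ↑ˢ-⊆ {p = _ ∷ p} {_ ∷ q} p⊆q {suc x} (there x∈p) = there (↑ˢ-⊆ (drop-∷-⊆ p⊆q) x∈p)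

  ↑ˢ-∉ : ∀ {n} {x : Fin n} {p : Subset n} → x ∉ p → x ↑ˡ m ∉ p ↑ˢ m
  ↑ˢ-∉ {x = x} {p} x∉p x∈p↑ =
    x∉p (lookup⇒[]= x p (trans (sym (lookup-++ˡ p _ x)) ([]=⇒lookup x∈p↑)))

module _ {k} (N : Matroid k) where

  ∈⇒∈cl : ∀ {X y} → y ∈ X → InCl N y X
  ∈⇒∈cl {X} {y} y∈X = ≤-antisym (rank-mono N _ _ X∪⁅y⁆⊆X) (rank-mono N _ _ (p⊆p∪q ⁅ y ⁆))
    where
    X∪⁅y⁆⊆X : X ∪ ⁅ y ⁆ ⊆ X
    X∪⁅y⁆⊆X z∈ with x∈p∪q⁻ X ⁅ y ⁆ z∈
    ... | inj₁ z∈X  = z∈X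
    ... | inj₂ z∈⁅y⁆ rewrite x∈⁅y⁆⇒x≡y y z∈⁅y⁆ = y∈X

  rank-∪-absorb-∪ : ∀ {X P Q} → rank N (X ∪ P) ≤ rank N X → rank N (X ∪ Q) ≤ rank N X →
    rank N (X ∪ (P ∪ Q)) ≤ rank N X
  rank-∪-absorb-∪ {X} {P} {Q} P≤ Q≤ = +-cancelʳ-≤ (rank N X) _ _ (begin
    rank N (X ∪ (P ∪ Q)) + rank N X
      ≡⟨ cong (λ S → rank N S + rank N X) X∪[P∪Q]≡[X∪P]∪[X∪Q] ⟩
    rank N ((X ∪ P) ∪ (X ∪ Q)) + rank N X
      ≤⟨ +-monoʳ-≤ _ (rank-mono N _ _ λ x∈X → x∈p∩q⁺ (p⊆p∪q P x∈X , p⊆p∪q Q x∈X)) ⟩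
    rank N ((X ∪ P) ∪ (X ∪ Q)) + rank N ((X ∪ P) ∩ (X ∪ Q))
      ≤⟨ rank-submod N _ _ ⟩
    rank N (X ∪ P) + rank N (X ∪ Q)
      ≤⟨ +-mono-≤ P≤ Q≤ ⟩
    rank N X + rank N X ∎)
    where
    open ≤-Reasoning
    open ICMSolver (∪-idempotentCommutativeMonoid k) using (Expr; prove; var; _⊕_)
    X∪[P∪Q]≡[X∪P]∪[X∪Q] : X ∪ (P ∪ Q) ≡ (X ∪ P) ∪ (X ∪ Q)
    X∪[P∪Q]≡[X∪P]∪[X∪Q] = prove 3 (x ⊕ (p ⊕ q)) ((x ⊕ p) ⊕ (x ⊕ q)) (X ∷ P ∷ Q ∷ [])
      where
      x p q : Expr 3
      x = var zero
      p = var (suc zero)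
      q = var (suc (suc zero))

  rank-∪-absorb-⋃ : ∀ {X} {Ps : List (Subset k)} → All (λ P → rank N (X ∪ P) ≤ rank N X) Ps →
    rank N (X ∪ ⋃ Ps) ≤ rank N X
  rank-∪-absorb-⋃ {X} []         = ≤-reflexive (cong (rank N) (∪-identityʳ X))
  rank-∪-absorb-⋃     (P≤ ∷ Ps≤) = rank-∪-absorb-∪ P≤ (rank-∪-absorb-⋃ Ps≤)

  rank-∪-absorb : ∀ {X C} → (∀ {y} → y ∈ C → InCl N y X) → rank N (X ∪ C) ≤ rank N X
  rank-∪-absorb {X} {C} C⊆clX =
    ≤-trans (rank-mono N _ _ X∪C⊆X∪⋃)
      (rank-∪-absorb-⋃ (map⁺ (All.map (λ y∈C → ≤-reflexive (C⊆clX y∈C)) (all-filter (_∈? C) (allFin k)))))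
    where
    elements : List (Fin k)
    elements = filter (_∈? C) (allFin k)
    X∪C⊆X∪⋃ : X ∪ C ⊆ X ∪ ⋃ (map ⁅_⁆ elements)
    X∪C⊆X∪⋃ z∈ with x∈p∪q⁻ X C z∈
    ... | inj₁ z∈X = p⊆p∪q _ z∈X
    ... | inj₂ z∈C = q⊆p∪q X _ (∈-⋃⁺ (x∈⁅x⁆ _) (∈-map⁺ ⁅_⁆ (∈-filter⁺ (_∈? C) (∈-allFin _) z∈C)))

  clone-∈cl : ∀ {X x y} → Clones N x y → x ∉ X → InCl N x X → InCl N y X
  clone-∈cl {X} {x} {y} x≈y x∉X x∈clX with y ∈? X
  ... | yes y∈X = ∈⇒∈cl y∈X
  ... | no  y∉X = begin
    rank N (X ∪ ⁅ y ⁆)                 ≡⟨ x≈y (X ∪ ⁅ y ⁆) ⟨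
    rank N (swapSet x y (X ∪ ⁅ y ⁆))   ≡⟨ cong (rank N) (swapSet-∪⁅⁆ x∉X y∉X) ⟩
    rank N (X ∪ ⁅ x ⁆)                 ≡⟨ x∈clX ⟩
    rank N X                           ∎
    where open ≡-Reasoning

  independentClonalClass-bound : ∀ {C X Y e} → ClonalClass N C → Independent N C → e ∈ C →
    e ∉ X → e ∉ Y → InCl N e X → InCl N e Y →
    ∣ C ∣ + rank N ((X ∪ Y) ∪ ⁅ e ⁆) ≤ rank N X + rank N Y
  independentClonalClass-bound {C} {X} {Y} {e} (clones , _) indep e∈C e∉X e∉Y e∈clX e∈clY = begin
    ∣ C ∣ + rank N ((X ∪ Y) ∪ ⁅ e ⁆)
      ≡⟨ cong (_+ _) indep ⟨
    rank N C + rank N ((X ∪ Y) ∪ ⁅ e ⁆)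
      ≤⟨ +-mono-≤ (rank-mono N _ _ C⊆∩) (rank-mono N _ _ covered) ⟩
    rank N ((X ∪ C) ∩ (Y ∪ C)) + rank N ((X ∪ C) ∪ (Y ∪ C))
      ≡⟨ +-comm (rank N ((X ∪ C) ∩ (Y ∪ C))) _ ⟩
    rank N ((X ∪ C) ∪ (Y ∪ C)) + rank N ((X ∪ C) ∩ (Y ∪ C))
      ≤⟨ rank-submod N _ _ ⟩
    rank N (X ∪ C) + rank N (Y ∪ C)
      ≤⟨ +-mono-≤ (rank-∪-absorb (λ y∈C → clone-∈cl (clones e _ e∈C y∈C) e∉X e∈clX))
                  (rank-∪-absorb (λ y∈C → clone-∈cl (clones e _ e∈C y∈C) e∉Y e∈clY)) ⟩
    rank N X + rank N Y ∎
    where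
    open ≤-Reasoning
    C⊆∩ : C ⊆ (X ∪ C) ∩ (Y ∪ C)
    C⊆∩ z∈C = x∈p∩q⁺ (q⊆p∪q X C z∈C , q⊆p∪q Y C z∈C)
    covered : (X ∪ Y) ∪ ⁅ e ⁆ ⊆ (X ∪ C) ∪ (Y ∪ C)
    covered z∈ with x∈p∪q⁻ (X ∪ Y) ⁅ e ⁆ z∈
    ... | inj₂ z∈⁅e⁆ rewrite x∈⁅y⁆⇒x≡y e z∈⁅e⁆ = p⊆p∪q (Y ∪ C) (q⊆p∪q X C e∈C)
    ... | inj₁ z∈X∪Y with x∈p∪q⁻ X Y z∈X∪Y
    ...   | inj₁ z∈X = p⊆p∪q (Y ∪ C) (p⊆p∪q C z∈X)
    ...   | inj₂ z∈Y = q⊆p∪q (X ∪ C) _ (p⊆p∪q C z∈Y)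

InClosure-↑ : ∀ {n m} {r : Subset n → ℕ} {N : Matroid (n + m)} → IsExtension r N →
  ∀ {e S} → InClosure r e S → InCl N (e ↑ˡ m) (S ↑ˢ m)
InClosure-↑ {m = m} {r} {N} ext {e} {S} e∈clS = begin
  rank N ((S ↑ˢ m) ∪ ⁅ e ↑ˡ m ⁆)        ≡⟨ cong (λ T → rank N ((S ↑ˢ m) ∪ T)) (↑ˢ-⁅⁆ m e) ⟨
  rank N ((S ↑ˢ m) ∪ (⁅ e ⁆ ↑ˢ m))     ≡⟨ cong (rank N) (↑ˢ-∪ m S ⁅ e ⁆) ⟨
  rank N ((S ∪ ⁅ e ⁆) ↑ˢ m)            ≡⟨ ext (S ∪ ⁅ e ⁆) ⟩
  r (S ∪ ⁅ e ⁆)                        ≡⟨ e∈clS ⟩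
  r S                                  ≡⟨ ext S ⟨
  rank N (S ↑ˢ m)                      ∎
  where open ≡-Reasoning

freedomAtMost-mono : ∀ {n} {r : Subset n → ℕ} {e s t} → s ≤ t → FreedomAtMostOf r e s → FreedomAtMostOf r e t
freedomAtMost-mono s≤t freedom≤s m N ext C class indep e∈C = ≤-trans (freedom≤s m N ext C class indep e∈C) s≤t

freedom≤connectivity : ∀ {n} (r : Subset n → ℕ) {e} (A : Subset n) →
  InClosure r e (A - e) → InClosure r e (∁ A - e) → FreedomAtMostOf r e (r A + r (∁ A) ∸ r ⊤)
freedom≤connectivity {n} r {e} A e∈clA e∈clB m N ext C class indep e∈C = m+n≤o⇒m≤o∸n ∣ C ∣ (begin
  ∣ C ∣ + r ⊤                                  ≡⟨ cong (λ T → ∣ C ∣ + T) (trans (sym (ext ⊤)) (cong (rank N) ⊤↑≡X∪Y∪⁅e⁆)) ⟩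
  ∣ C ∣ + rank N ((X ∪ Y) ∪ ⁅ e ↑ˡ m ⁆)        ≤⟨ independentClonalClass-bound N class indep e∈C
                                                    (↑ˢ-∉ m (x∉p-x A e)) (↑ˢ-∉ m (x∉p-x (∁ A) e))
                                                    (InClosure-↑ {r = r} {N} ext e∈clA) (InClosure-↑ {r = r} {N} ext e∈clB) ⟩
  rank N X + rank N Y                          ≤⟨ +-mono-≤ (rank-mono N _ _ (↑ˢ-⊆ m (p─q⊆p A ⁅ e ⁆)))
                                                           (rank-mono N _ _ (↑ˢ-⊆ m (p─q⊆p (∁ A) ⁅ e ⁆))) ⟩
  rank N (A ↑ˢ m) + rank N (∁ A ↑ˢ m)          ≡⟨ cong₂ _+_ (ext A) (ext (∁ A)) ⟩
  r A + r (∁ A)                                ∎)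
  where
  open ≤-Reasoning
  X Y : Subset (n + m)
  X = (A - e) ↑ˢ m
  Y = (∁ A - e) ↑ˢ m
  ⊤↑≡X∪Y∪⁅e⁆ : ⊤ ↑ˢ m ≡ (X ∪ Y) ∪ ⁅ e ↑ˡ m ⁆
  ⊤↑≡X∪Y∪⁅e⁆ = trans (cong (_↑ˢ m) (sym (p-x∪∁p-x∪⁅x⁆≡⊤ A e)))
    (trans (↑ˢ-∪ m _ ⁅ e ⁆) (cong₂ _∪_ (↑ˢ-∪ m (A - e) (∁ A - e)) (↑ˢ-⁅⁆ m e)))

∸-+-∸ : ∀ {p q R} → R ≤ p → R ≤ q → (p ∸ R) + (q ∸ R) ≡ p + q ∸ R ∸ R
∸-+-∸ {p} {q} {R} R≤p R≤q = begin
  (p ∸ R) + (q ∸ R)  ≡⟨ +-∸-comm (q ∸ R) R≤p ⟨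
  p + (q ∸ R) ∸ R    ≡⟨ cong (_∸ R) (+-∸-assoc p R≤q) ⟨
  p + q ∸ R ∸ R      ∎
  where open ≡-Reasoning

module _ {n} (M : Matroid n) where
  open BooleanAlgebraProperties (∪-∩-booleanAlgebra n) using (¬-involutive; ¬⊤≈⊥)

  rank-⊤≤rank+rank∁ : ∀ A → rank M ⊤ ≤ rank M A + rank M (∁ A)
  rank-⊤≤rank+rank∁ A = begin
    rank M ⊤                                   ≡⟨ cong (rank M) (p∪∁p≡⊤ A) ⟨
    rank M (A ∪ ∁ A)                           ≤⟨ m≤m+n _ _ ⟩
    rank M (A ∪ ∁ A) + rank M (A ∩ ∁ A)        ≤⟨ rank-submod M A (∁ A) ⟩
    rank M A + rank M (∁ A)                    ∎
    where open ≤-Reasoning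

  dualRank-⊤ : dualRank M ⊤ ≡ n ∸ rank M ⊤
  dualRank-⊤ = cong (_∸ rank M ⊤) (begin
    ∣ ⊤ {n} ∣ + rank M (∁ ⊤) ≡⟨ cong₂ _+_ (∣⊤∣≡n n) (cong (rank M) ¬⊤≈⊥) ⟩
    n + rank M ⊥             ≡⟨ cong (n +_) (n≤0⇒n≡0 (≤-trans (rank-bound M ⊥) (≤-reflexive (∣⊥∣≡0 n)))) ⟩
    n + 0                    ≡⟨ +-identityʳ n ⟩
    n                        ∎)
    where open ≡-Reasoning

  dualConnectivity : ∀ A → dualRank M A + dualRank M (∁ A) ∸ dualRank M ⊤ ≡ connectivity M A
  dualConnectivity A = begin
    (a + y ∸ R) + dualRank M (∁ A) ∸ dualRank M ⊤
      ≡⟨ cong₂ (λ u v → (a + y ∸ R) + u ∸ v) (cong (λ S → b + rank M S ∸ R) (¬-involutive A)) dualRank-⊤ ⟩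
    (a + y ∸ R) + (b + x ∸ R) ∸ (n ∸ R)
      ≡⟨ cong (_∸ (n ∸ R)) (∸-+-∸ R≤a+y R≤b+x) ⟩
    (a + y) + (b + x) ∸ R ∸ R ∸ (n ∸ R)
      ≡⟨ cong (λ s → s ∸ R ∸ R ∸ (n ∸ R)) (trans (regroup a y b x) (cong (_+ (x + y)) a+b≡n)) ⟩
    n + (x + y) ∸ R ∸ R ∸ (n ∸ R)
      ≡⟨ cong (_∸ (n ∸ R)) (∸-+-∸ R≤n R≤x+y) ⟨
    (n ∸ R) + (x + y ∸ R) ∸ (n ∸ R)
      ≡⟨ m+n∸m≡n (n ∸ R) _ ⟩
    x + y ∸ R ∎
    where
    open ≡-Reasoning
    a b x y R : ℕ
    a = ∣ A ∣
    b = ∣ ∁ A ∣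
    x = rank M A
    y = rank M (∁ A)
    R = rank M ⊤
    regroup : ∀ a y b x → (a + y) + (b + x) ≡ (a + b) + (x + y)
    regroup = solve-∀
    a+b≡n : a + b ≡ n
    a+b≡n = trans (cong (a +_) (∣∁p∣≡n∸∣p∣ A)) (m+[n∸m]≡n (∣p∣≤n A))
    R≤x+y : R ≤ x + y
    R≤x+y = rank-⊤≤rank+rank∁ A
    R≤a+y : R ≤ a + y
    R≤a+y = ≤-trans R≤x+y (+-monoˡ-≤ y (rank-bound M A))
    R≤b+x : R ≤ b + x
    R≤b+x = ≤-trans R≤x+y (≤-trans (≤-reflexive (+-comm x y)) (+-monoˡ-≤ x (rank-bound M (∁ A))))
    R≤n : R ≤ n
    R≤n = ≤-trans (rank-bound M ⊤) (≤-reflexive (∣⊤∣≡n n))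

lemma3p8 : ∀ {n} (M : Matroid n) (t : ℕ) (e : Fin n) (A : Subset n) →
    connectivity M A < suc t →
    ((InCl M e (A - e) × InCl M e (∁ A - e)) → FreedomAtMost M e t) ×
    ((InCoCl M e (A - e) × InCoCl M e (∁ A - e)) → CofreedomAtMost M e t)
lemma3p8 M t e A λ<1+t =
  (λ (e∈clA , e∈clB) →
     freedomAtMost-mono (≤-pred λ<1+t) (freedom≤connectivity (rank M) A e∈clA e∈clB)) ,
  (λ (e∈cl*A , e∈cl*B) →
     freedomAtMost-mono (≤-pred (subst (_< suc t) (sym (dualConnectivity M A)) λ<1+t))
       (freedom≤connectivity (dualRank M) A e∈cl*A e∈cl*B))
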